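{- For $i\in[k]$ let $H_i$ be a non-bipartite graph, let $a_i:=\chi(H_i)$, $r:=R(a_1-1,\ldots,a_k-1)$ and $r^*:=r^*(H_1,\ldots,H_k)$. There is $\gamma_0\le\min\{1/k,1/r\}$ such that for every $0<\gamma\le\gamma_0$ there is $\varepsilon_0>0$ such that for every $0<\varepsilon\le\varepsilon_0$ there is $N_0$ such that for every $N\ge N_0$ the following holds. Let $V_1,\ldots,V_m$ be disjoint sets each of size at least $N$, let $V:=V_1\cup\cdots\cup V_m$, let $\phi:\binom{V}{2}\to[k]$, and let $G^{\mathrm{nim}}$ be the NIM-graph of $\phi$. Then the reduced graph $R:=R(\varepsilon,\gamma,\phi|_{E(G^{\mathrm{nim}})},(V_i)_{i=1}^m)$ contains no $K_{r^*+1}$.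
   Context: $R(b_1,\ldots,b_k)$ is the multicolour Ramsey number. For $\phi$ a $k$-colouring of the pairs of $V$, an edge is a NIM-edge if for no $i\in[k]$ it lies in a copy of $H_i$ all of whose edges have colour $i$; $G^{\mathrm{nim}}$ is the graph on $V$ of NIM-edges, and $G^{\mathrm{nim}}_\ell$ its subgraph of colour-$\ell$ NIM-edges. For a graph and disjoint nonempty $X,Y$, $d(X,Y)=e(X,Y)/(|X||Y|)$; $(X,Y)$ is $\varepsilon$-regular if $|d(X,Y)-d(X',Y')|\le\varepsilon$ for all $X'\subseteq X$, $Y'\subseteq Y$ with $|X'|\ge\varepsilon|X|$, $|Y'|\ge\varepsilon|Y|$. The reduced graph $R(\varepsilon,\gamma,\phi|_{E(G^{\mathrm{nim}})},(V_i)_{i=1}^m)$ has vertex set $\{V_1,\ldots,V_m\}$, with $V_iV_j$ an edge iff $(V_i,V_j)$ is $\varepsilon$-regular in $G^{\mathrm{nim}}_\ell$ for every $\ell\in[k]$ and has density at least $\gamma$ in $G^{\mathrm{nim}}_\ell$ for some $\ell\in[k]$. A colouring $\xi:\binom{[s]}{\le 2}\to[k]$ (subsets of $[s]$ of size at most 2) is feasible if (P1) for each $i$ there is no homomorphism from $H_i$ into the graph on $[s]$ of pairs of $\xi$-colour $i$, and (P2) $\xi(\{x,y\})\ne\xi(\{x\})$ for distinct $x,y$; $r^*(H_1,\ldots,H_k)$ is the largest $s$ admitting a feasible colouring.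
   Formalization: The parameters γ and ε range over the rationals, and the constants γ₀ and ε₀ are taken in the rationals. -}

module Defs where

open import Data.Nat using (ℕ; zero; suc; _+_; _∸_) renaming (_*_ to _*ℕ_; _≤_ to _≤ℕ_)
open import Data.Bool using (Bool; true; false; _∧_; if_then_else_)
open import Data.Fin using (Fin; zero; suc)
import Data.Fin as Fin
open import Data.Product using (Σ; ∃; ∃-syntax; _×_; _,_)
open import Data.Integer using (+_)
open import Data.Rational using (ℚ; _/_; _≤_; _<_; _-_; _*_; ∣_∣; 0ℚ)
open import Relation.Binary.PropositionalEquality using (_≡_; _≢_)
open import Relation.Nullary using (¬_)
open import Relation.Nullary.Decidable using (⌊_⌋)
open import Function.Definitions using (Injective)
open import Function.Bundles using (_⇔_)

record Graph : Set where
  field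
    n     : ℕ
    adj   : Fin n → Fin n → Bool
    sym   : ∀ u v → adj u v ≡ adj v u
    irref : ∀ u → adj u u ≡ false
open Graph public

ProperColouring : (H : Graph) → ℕ → Set
ProperColouring H c =
  Σ (Fin (n H) → Fin c) λ col → ∀ u v → adj H u v ≡ true → col u ≢ col v

IsChromaticNumber : Graph → ℕ → Set
IsChromaticNumber H a =
  ProperColouring H a × (∀ c → ProperColouring H c → a ≤ℕ c)

NonBipartite : Graph → Set
NonBipartite H = ¬ ProperColouring H 2

-- Colourings of the pairs of a vertex type (values on the diagonal are
-- irrelevant; symmetry makes it a colouring of unordered pairs)

record PairColouring (V : Set) (k : ℕ) : Set where
  field
    col  : V → V → Fin k
    csym : ∀ u v → col u v ≡ col v u
open PairColouring public

Arrows : (n k : ℕ) → (Fin k → ℕ) → Set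
Arrows n k b = ∀ (φ : PairColouring (Fin n) k) →
  ∃[ i ] Σ (Fin (b i) → Fin n) λ f → Injective _≡_ _≡_ f ×
    (∀ p q → p ≢ q → col φ (f p) (f q) ≡ i)

IsRamseyNumber : (k : ℕ) → (Fin k → ℕ) → ℕ → Set
IsRamseyNumber k b r = Arrows r k b × (∀ n → Arrows n k b → r ≤ℕ n)

-- r*(H_1,…,H_k).  ξ on subsets of size ≤ 2 is given by its values on
-- singletons (ξv) and on 2-sets (ξe, symmetric); the value on ∅ plays no
-- role in (P1),(P2) and is omitted.

Feasible : (k : ℕ) → (Fin k → Graph) → (s : ℕ) →
           (Fin s → Fin k) → PairColouring (Fin s) k → Set
Feasible k H s ξv ξe =
  (∀ i → ¬ (Σ (Fin (n (H i)) → Fin s) λ h → ∀ p q → adj (H i) p q ≡ true →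
              (h p ≢ h q) × (col ξe (h p) (h q) ≡ i)))
  × (∀ x y → x ≢ y → col ξe x y ≢ ξv x)

HasFeasible : (k : ℕ) → (Fin k → Graph) → ℕ → Set
HasFeasible k H s = Σ (Fin s → Fin k) λ ξv → Σ (PairColouring (Fin s) k) λ ξe →
  Feasible k H s ξv ξe

IsRStar : (k : ℕ) → (Fin k → Graph) → ℕ → Set
IsRStar k H r* = HasFeasible k H r* × (∀ s → HasFeasible k H s → s ≤ℕ r*)

InMonoCopy : {V : Set} {k : ℕ} → PairColouring V k → Graph → Fin k → V → V → Set
InMonoCopy {V} φ H i u v =
  Σ (Fin (n H) → V) λ f → Injective _≡_ _≡_ f ×
    (∃[ p ] ∃[ q ] (adj H p q ≡ true) × (f p ≡ u) × (f q ≡ v)) ×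
    (∀ p q → adj H p q ≡ true → col φ (f p) (f q) ≡ i)

IsNIM : {V : Set} {k : ℕ} → (Fin k → Graph) → PairColouring V k → V → V → Set
IsNIM {k = k} H φ u v = ∀ (i : Fin k) → ¬ InMonoCopy φ (H i) i u v

NIMIndicator : {V : Set} {k : ℕ} → (Fin k → Graph) → PairColouring V k →
               (V → V → Bool) → Set
NIMIndicator {V} H φ nim = ∀ (u v : V) → u ≢ v → (nim u v ≡ true) ⇔ IsNIM H φ u v

count : (n : ℕ) → (Fin n → Bool) → ℕ
count zero    P = 0
count (suc n) P = (if P zero then 1 else 0) + count n (λ x → P (suc x))

sumFin : (n : ℕ) → (Fin n → ℕ) → ℕ
sumFin zero    f = 0
sumFin (suc n) f = f zero + sumFin n (λ x → f (suc x))

ℕtoℚ : ℕ → ℚ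
ℕtoℚ a = (+ a) / 1

-- e / d as a rational (0 if d = 0)
ratio : ℕ → ℕ → ℚ
ratio e zero    = 0ℚ
ratio e (suc d) = (+ e) / (suc d)

-- the vertex set V = V_1 ∪ … ∪ V_m, realised as a disjoint union
Vert : (m : ℕ) → (Fin m → ℕ) → Set
Vert m sz = Σ (Fin m) λ i → Fin (sz i)

module _ {m k : ℕ} {sz : Fin m → ℕ}
         (φ : PairColouring (Vert m sz) k) (nim : Vert m sz → Vert m sz → Bool) where

  nimEdge : Fin k → Vert m sz → Vert m sz → Bool
  nimEdge ℓ u v = nim u v ∧ ⌊ col φ u v Fin.≟ ℓ ⌋

  eCount : Fin k → (i j : Fin m) → (Fin (sz i) → Bool) → (Fin (sz j) → Bool) → ℕ
  eCount ℓ i j X Y =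
    sumFin (sz i) λ x → count (sz j) (λ y → X x ∧ Y y ∧ nimEdge ℓ (i , x) (j , y))

  density : Fin k → (i j : Fin m) → (Fin (sz i) → Bool) → (Fin (sz j) → Bool) → ℚ
  density ℓ i j X Y =
    ratio (eCount ℓ i j X Y) (count (sz i) X *ℕ count (sz j) Y)

  full : (a : ℕ) → Fin a → Bool
  full a _ = true

  Regular : ℚ → Fin k → Fin m → Fin m → Set
  Regular ε ℓ i j =
    ∀ (X : Fin (sz i) → Bool) (Y : Fin (sz j) → Bool) →
      ε * ℕtoℚ (sz i) ≤ ℕtoℚ (count (sz i) X) →
      ε * ℕtoℚ (sz j) ≤ ℕtoℚ (count (sz j) Y) →
      ∣ density ℓ i j (full (sz i)) (full (sz j)) - density ℓ i j X Y ∣ ≤ ε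

  ReducedEdge : ℚ → ℚ → Fin m → Fin m → Set
  ReducedEdge ε γ i j =
    (i ≢ j) × (∀ ℓ → Regular ε ℓ i j) ×
    (∃[ ℓ ] γ ≤ density ℓ i j (full (sz i)) (full (sz j)))

  ReducedHasClique : ℚ → ℚ → ℕ → Set
  ReducedHasClique ε γ t =
    Σ (Fin t → Fin m) λ f → Injective _≡_ _≡_ f ×
      (∀ p q → p ≢ q → ReducedEdge ε γ (f p) (f q))

-- Suppose the reduced graph contains a clique on the parts V_{f 0}, …, V_{f r*}. Colour each
-- pair of the clique by a colour ℓ in which it is ε-regular with NIM-density at least γ ≥ 2/D.
-- As ε ≤ 1/E, every pair of 1/E-fractions of the two parts then still has NIM-density at least
-- 1/D in colour ℓ, and this lets a greedy argument embed, one vertex at a time, any bounded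
-- pattern whose edges lie in such pairs. The colouring is then feasible on r* + 1 points,
-- contradicting the maximality of r*. For (P1), a homomorphism of H_i into colour i would embed
-- a colour-i copy of H_i made of NIM-edges. For (P2), a point x seeing every colour would give
-- a fan: a hub of each colour c joined by NIM-edges of colour c to many leaves in V_{f x}; Ramsey's
-- theorem among the leaves then yields a colour-c copy of H_c through a NIM-edge.

module Submission where

open import Data.Nat using (ℕ; NonZero)
open import Data.Fin using (Fin)
open import Data.Bool using (Bool)
open import Defs hiding (sym)

module Fractions where

  open import Data.Nat as ℕ using (ℕ; zero; suc)
  import Data.Nat.Properties as ℕ
  open import Data.Nat.Solver using (module +-*-Solver)
  open import Data.Integer as ℤ using (+_)
  import Data.Integer.Properties as ℤ
  open import Data.Rational
    using (ℚ; mkℚ; _/_; _≤_; _<_; _+_; _*_; _-_; -_; ∣_∣; 0ℚ; toℚᵘ; NonNegative; *<*)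
  open import Data.Rational.Properties
  open import Data.Rational.Unnormalised as ℚᵘ using (ℚᵘ; mkℚᵘ; *≤*)
  import Data.Rational.Unnormalised.Properties as ℚᵘ
  open import Data.Product using (∃-syntax; _,_)
  open import Data.Sum using (inj₁; inj₂)
  open import Relation.Binary.PropositionalEquality
  open import Relation.Nullary using (contradiction)

  frac : ℕ → ℕ → ℚ
  frac a b = + a / suc b

  private
    fracᵘ : ℕ → ℕ → ℚᵘ
    fracᵘ a b = mkℚᵘ (+ a) b

    toℚᵘ-frac : ∀ a b → toℚᵘ (frac a b) ℚᵘ.≃ fracᵘ a b
    toℚᵘ-frac a b = toℚᵘ-fromℚᵘ (fracᵘ a b)

    pos-* : ∀ a b → + a ℤ.* + b ≡ + (a ℕ.* b)
    pos-* a b = sym (ℤ.pos-* a b)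

  frac-mono-≤ : ∀ {a b c d} → a ℕ.* suc d ℕ.≤ c ℕ.* suc b → frac a b ≤ frac c d
  frac-mono-≤ {a} {b} {c} {d} h = toℚᵘ-cancel-≤
    (ℚᵘ.≤-respˡ-≃ (ℚᵘ.≃-sym (toℚᵘ-frac a b)) (ℚᵘ.≤-respʳ-≃ (ℚᵘ.≃-sym (toℚᵘ-frac c d))
      (*≤* (subst₂ ℤ._≤_ (sym (pos-* a (suc d))) (sym (pos-* c (suc b))) (ℤ.+≤+ h)))))

  frac-cancel-≤ : ∀ {a b c d} → frac a b ≤ frac c d → a ℕ.* suc d ℕ.≤ c ℕ.* suc b
  frac-cancel-≤ {a} {b} {c} {d} h
    with ℚᵘ.≤-respˡ-≃ (toℚᵘ-frac a b) (ℚᵘ.≤-respʳ-≃ (toℚᵘ-frac c d) (toℚᵘ-mono-≤ h))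
  ... | *≤* h' = ℤ.drop‿+≤+ (subst₂ ℤ._≤_ (pos-* a (suc d)) (pos-* c (suc b)) h')

  frac-+ : ∀ a b c d → frac a b + frac c d ≡ frac (a ℕ.* suc d ℕ.+ c ℕ.* suc b) (d ℕ.+ b ℕ.* suc d)
  frac-+ a b c d = toℚᵘ-injective (ℚᵘ.≃-trans (toℚᵘ-homo-+ (frac a b) (frac c d))
    (ℚᵘ.≃-trans (ℚᵘ.+-cong (toℚᵘ-frac a b) (toℚᵘ-frac c d))
    (ℚᵘ.≃-trans (ℚᵘ.≃-reflexive numerator) (ℚᵘ.≃-sym (toℚᵘ-frac _ _)))))
    where
    numerator : fracᵘ a b ℚᵘ.+ fracᵘ c d ≡ fracᵘ (a ℕ.* suc d ℕ.+ c ℕ.* suc b) (d ℕ.+ b ℕ.* suc d)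
    numerator = cong (λ z → mkℚᵘ z (d ℕ.+ b ℕ.* suc d))
      (trans (cong₂ ℤ._+_ (pos-* a (suc d)) (pos-* c (suc b))) (sym (ℤ.pos-+ (a ℕ.* suc d) (c ℕ.* suc b))))

  frac-* : ∀ a b c d → frac a b * frac c d ≡ frac (a ℕ.* c) (d ℕ.+ b ℕ.* suc d)
  frac-* a b c d = toℚᵘ-injective (ℚᵘ.≃-trans (toℚᵘ-homo-* (frac a b) (frac c d))
    (ℚᵘ.≃-trans (ℚᵘ.*-cong (toℚᵘ-frac a b) (toℚᵘ-frac c d))
    (ℚᵘ.≃-trans (ℚᵘ.≃-reflexive (cong (λ z → mkℚᵘ z (d ℕ.+ b ℕ.* suc d)) (pos-* a c)))
    (ℚᵘ.≃-sym (toℚᵘ-frac _ _)))))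

  frac-pos : ∀ a b → 0ℚ < frac (suc a) b
  frac-pos a b = positive⁻¹ (frac (suc a) b) {{normalize-pos (suc a) (suc b)}}

  frac-nonNeg : ∀ a b → NonNegative (frac a b)
  frac-nonNeg a b = normalize-nonNeg a (suc b)

  unitFrac-*-≤ : ∀ {a b c} → a ℕ.≤ suc b ℕ.* c → frac 1 b * ℕtoℚ a ≤ ℕtoℚ c
  unitFrac-*-≤ {a} {b} {c} h = subst (_≤ ℕtoℚ c) (sym (frac-* 1 b a 0)) (frac-mono-≤ {1 ℕ.* a} {0 ℕ.+ b ℕ.* 1} {c} {0} h')
    where
    h' : 1 ℕ.* a ℕ.* 1 ℕ.≤ c ℕ.* suc (0 ℕ.+ b ℕ.* 1)
    h' = subst₂ ℕ._≤_ (solve 2 (λ a b → a := con 1 :* a :* con 1) refl a b)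
      (solve 2 (λ b c → (con 1 :+ b) :* c := c :* (con 1 :+ (con 0 :+ b :* con 1))) refl b c) h
      where open +-*-Solver

  p≤∣p∣ : ∀ p → p ≤ ∣ p ∣
  p≤∣p∣ p with ∣p∣≡p∨∣p∣≡-p p
  ... | inj₁ ∣p∣≡p = ≤-reflexive (sym ∣p∣≡p)
  ... | inj₂ ∣p∣≡-p = ≤-trans p≤0 (0≤∣p∣ p)
    where
    p≤0 : p ≤ 0ℚ
    p≤0 = subst₂ _≤_ (+-identityʳ p) (+-inverseʳ p)
      (+-monoʳ-≤ p (subst (0ℚ ≤_) ∣p∣≡-p (0≤∣p∣ p)))

  p+p≤q⇒∣q-r∣≤p⇒p≤r : ∀ {p q r} → p + p ≤ q → ∣ q - r ∣ ≤ p → p ≤ r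
  p+p≤q⇒∣q-r∣≤p⇒p≤r {p} {q} {r} p+p≤q ∣q-r∣≤p = subst₂ _≤_ (-p+[p+x]≡x p) (-p+[p+x]≡x r)
    (+-monoʳ-≤ (- p) (≤-trans p+p≤q q≤p+r))
    where
    -p+[p+x]≡x : ∀ x → - p + (p + x) ≡ x
    -p+[p+x]≡x x = trans (sym (+-assoc (- p) p x)) (trans (cong (_+ x) (+-inverseˡ p)) (+-identityˡ x))
    q≤p+r : q ≤ p + r
    q≤p+r = subst₂ _≤_ (trans (+-assoc q (- r) r) (trans (cong (λ x → q + x) (+-inverseˡ r)) (+-identityʳ q))) refl
      (+-monoˡ-≤ r (≤-trans (p≤∣p∣ (q - r)) ∣q-r∣≤p))

  positive⇒∃unitFrac+unitFrac≤ : ∀ {γ} → 0ℚ < γ → ∃[ d ] frac 1 d + frac 1 d ≤ γ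
  positive⇒∃unitFrac+unitFrac≤ {mkℚ (+ zero) _ _} (*<* 0<0) = contradiction 0<0 (ℤ.<-irrefl refl)
  positive⇒∃unitFrac+unitFrac≤ γ@{mkℚ (+ suc p) q _} _ = d ,
    subst₂ _≤_ (sym (frac-+ 1 d 1 d)) (↥p/↧p≡p γ)
      (frac-mono-≤ {1 ℕ.* suc d ℕ.+ 1 ℕ.* suc d} {d ℕ.+ d ℕ.* suc d} {suc p} {q}
        (ℕ.≤-trans (ℕ.≤-reflexive same) (ℕ.m≤n*m _ (suc p))))
    where
    d = q ℕ.+ suc q
    same : (1 ℕ.* suc d ℕ.+ 1 ℕ.* suc d) ℕ.* suc q ≡ suc (d ℕ.+ d ℕ.* suc d)
    same = solve 1 (λ q → (con 1 :* (con 1 :+ (q :+ (con 1 :+ q))) :+ con 1 :* (con 1 :+ (q :+ (con 1 :+ q)))) :* (con 1 :+ q)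
                   := (con 1 :+ ((q :+ (con 1 :+ q)) :+ (q :+ (con 1 :+ q)) :* (con 1 :+ (q :+ (con 1 :+ q)))))) refl q
      where open +-*-Solver
  positive⇒∃unitFrac+unitFrac≤ {mkℚ ℤ.-[1+ _ ] _ _} (*<* neg>0) = contradiction neg>0 (ℤ.<-asym ℤ.-<+)

  unitFrac≤ratio⇒≤ : ∀ {d a c} → frac 1 d ≤ ratio a c → c ℕ.≤ suc d ℕ.* a
  unitFrac≤ratio⇒≤ {c = zero} _ = ℕ.z≤n
  unitFrac≤ratio⇒≤ {d} {a} {suc c} le =
    subst₂ ℕ._≤_ (ℕ.*-identityˡ (suc c)) (ℕ.*-comm a (suc d)) (frac-cancel-≤ {1} {d} {a} {c} le)

module Counting where

  open import Data.Nat using (ℕ; zero; suc; _+_; _*_; _≤_; _<_; z≤n; s≤s; >-nonZero)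
  open import Data.Nat.Properties hiding (_≟_)
  open import Data.Nat.Solver using (module +-*-Solver)
  import Algebra.Properties.CommutativeSemigroup
  open import Data.Bool using (Bool; true; false; _∧_; _∨_; not; if_then_else_)
  open import Data.Bool.Properties using (∨-conicalˡ; ∨-conicalʳ)
  open import Data.Fin using (Fin; zero; suc; _≟_)
  open import Data.Product using (∃-syntax; _,_)
  open import Relation.Binary.PropositionalEquality
  open import Relation.Nullary using (Dec; yes; no; ¬_; contradiction)
  open import Relation.Nullary.Decidable using (⌊_⌋; dec-false)

  ⌊⌋-true : ∀ {A : Set} (a? : Dec A) → ⌊ a? ⌋ ≡ true → A
  ⌊⌋-true (yes a) _ = a

  ⌊⌋-false : ∀ {A : Set} (a? : Dec A) → ⌊ a? ⌋ ≡ false → ¬ A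
  ⌊⌋-false (no ¬a) _ = ¬a

  not⌊⌋-true : ∀ {A : Set} (a? : Dec A) → not ⌊ a? ⌋ ≡ true → ¬ A
  not⌊⌋-true (no ¬a) _ = ¬a

  not≡true⇒≡false : ∀ {b} → not b ≡ true → b ≡ false
  not≡true⇒≡false {false} _ = refl

  ≡true-⇔⇒≡ : ∀ {a b} → (a ≡ true → b ≡ true) → (b ≡ true → a ≡ true) → a ≡ b
  ≡true-⇔⇒≡ {false} {false} _ _ = refl
  ≡true-⇔⇒≡ {false} {true}  _ b⇒a = b⇒a refl
  ≡true-⇔⇒≡ {true}  {_}     a⇒b _ = sym (a⇒b refl)

  indicator : Bool → ℕ
  indicator b = if b then 1 else 0

  count-false : ∀ n → count n (λ _ → false) ≡ 0
  count-false zero = refl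
  count-false (suc n) = count-false n

  count-true : ∀ n → count n (λ _ → true) ≡ n
  count-true zero = refl
  count-true (suc n) = cong suc (count-true n)

  count-cong : ∀ n {P Q} → (∀ x → P x ≡ Q x) → count n P ≡ count n Q
  count-cong zero eq = refl
  count-cong (suc n) eq = cong₂ _+_ (cong indicator (eq zero)) (count-cong n (λ x → eq (suc x)))

  count-mono : ∀ n {P Q} → (∀ x → P x ≡ true → Q x ≡ true) → count n P ≤ count n Q
  count-mono zero P⊆Q = z≤n
  count-mono (suc n) {P} {Q} P⊆Q with P zero in P0 | Q zero in Q0
  ... | true  | true  = s≤s (count-mono n (λ x → P⊆Q (suc x)))
  ... | true  | false = contradiction (trans (sym (P⊆Q zero P0)) Q0) λ ()
  ... | false | true  = m≤n⇒m≤1+n (count-mono n (λ x → P⊆Q (suc x)))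
  ... | false | false = count-mono n (λ x → P⊆Q (suc x))

  count-∨ : ∀ n P Q → count n (λ x → P x ∨ Q x) ≤ count n P + count n Q
  count-∨ zero P Q = z≤n
  count-∨ (suc n) P Q with P zero | Q zero
  ... | true  | true  = s≤s (≤-trans (count-∨ n _ _) (+-monoʳ-≤ (count n (λ x → P (suc x))) (n≤1+n _)))
  ... | true  | false = s≤s (count-∨ n _ _)
  ... | false | true  = ≤-trans (s≤s (count-∨ n _ _)) (≤-reflexive (sym (+-suc _ _)))
  ... | false | false = count-∨ n _ _

  count-split : ∀ n P Q → count n P ≤ count n (λ x → P x ∧ not (Q x)) + count n Q
  count-split n P Q = ≤-trans (count-mono n P⊆) (count-∨ n _ Q)
    where
    P⊆ : ∀ x → P x ≡ true → (P x ∧ not (Q x)) ∨ Q x ≡ true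
    P⊆ x Px rewrite Px with Q x
    ... | true  = refl
    ... | false = refl

  count-pos⇒∃ : ∀ n P → 0 < count n P → ∃[ x ] P x ≡ true
  count-pos⇒∃ (suc n) P pos with P zero in P0
  ... | true  = zero , P0
  ... | false with count-pos⇒∃ n (λ x → P (suc x)) pos
  ...   | x , Px = suc x , Px

  sumFin-cong : ∀ n {f g} → (∀ x → f x ≡ g x) → sumFin n f ≡ sumFin n g
  sumFin-cong zero eq = refl
  sumFin-cong (suc n) eq = cong₂ _+_ (eq zero) (sumFin-cong n (λ x → eq (suc x)))

  sumFin-mono : ∀ n {f g} → (∀ x → f x ≤ g x) → sumFin n f ≤ sumFin n g
  sumFin-mono zero le = z≤n
  sumFin-mono (suc n) le = +-mono-≤ (le zero) (sumFin-mono n (λ x → le (suc x)))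

  sumFin-≤-* : ∀ n {f} c → (∀ x → f x ≤ c) → sumFin n f ≤ n * c
  sumFin-≤-* zero c le = z≤n
  sumFin-≤-* (suc n) c le = +-mono-≤ (le zero) (sumFin-≤-* n c (λ x → le (suc x)))

  sumFin-const : ∀ n c → sumFin n (λ _ → c) ≡ n * c
  sumFin-const zero c = refl
  sumFin-const (suc n) c = cong (c +_) (sumFin-const n c)

  sumFin-+ : ∀ n f g → sumFin n (λ x → f x + g x) ≡ sumFin n f + sumFin n g
  sumFin-+ zero f g = refl
  sumFin-+ (suc n) f g = trans (cong (f zero + g zero +_) (sumFin-+ n _ _))
    (interchange (f zero) (g zero) (sumFin n _) (sumFin n _))
    where open Algebra.Properties.CommutativeSemigroup +-commutativeSemigroup using (interchange)

  sumFin-*ˡ : ∀ n d f → sumFin n (λ x → d * f x) ≡ d * sumFin n f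
  sumFin-*ˡ zero d f = sym (*-zeroʳ d)
  sumFin-*ˡ (suc n) d f = trans (cong (d * f zero +_) (sumFin-*ˡ n d _)) (sym (*-distribˡ-+ d (f zero) _))

  sumFin-indicator : ∀ n P c → sumFin n (λ x → if P x then c else 0) ≡ count n P * c
  sumFin-indicator zero P c = refl
  sumFin-indicator (suc n) P c with P zero
  ... | true  = cong (c +_) (sumFin-indicator n _ c)
  ... | false = sumFin-indicator n _ c

  count≡sumFin : ∀ n P → count n P ≡ sumFin n (λ x → indicator (P x))
  count≡sumFin zero P = refl
  count≡sumFin (suc n) P = cong (indicator (P zero) +_) (count≡sumFin n _)

  sumFin-comm : ∀ a b (f : Fin a → Fin b → ℕ) →
    sumFin a (λ x → sumFin b (f x)) ≡ sumFin b (λ y → sumFin a (λ x → f x y))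
  sumFin-comm zero b f = sym (trans (sumFin-const b 0) (*-zeroʳ b))
  sumFin-comm (suc a) b f = trans (cong (sumFin b (f zero) +_) (sumFin-comm a b (λ x → f (suc x))))
    (sym (sumFin-+ b (f zero) _))

  count-comm : ∀ a b (F : Fin a → Fin b → Bool) →
    sumFin a (λ x → count b (F x)) ≡ sumFin b (λ y → count a (λ x → F x y))
  count-comm a b F = begin
    sumFin a (λ x → count b (F x))                        ≡⟨ sumFin-cong a (λ x → count≡sumFin b (F x)) ⟩
    sumFin a (λ x → sumFin b (λ y → indicator (F x y)))   ≡⟨ sumFin-comm a b _ ⟩
    sumFin b (λ y → sumFin a (λ x → indicator (F x y)))   ≡⟨ sumFin-cong b (λ y → count≡sumFin a (λ x → F x y)) ⟨
    sumFin b (λ y → count a (λ x → F x y))                ∎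
    where open ≡-Reasoning

  term≤sumFin : ∀ n (f : Fin n → ℕ) x → f x ≤ sumFin n f
  term≤sumFin (suc n) f zero = m≤m+n (f zero) _
  term≤sumFin (suc n) f (suc x) = ≤-trans (term≤sumFin n (λ y → f (suc y)) x) (m≤n+m _ (f zero))

  any : (L : ℕ) → (Fin L → Bool) → Bool
  any zero f = false
  any (suc L) f = f zero ∨ any L (λ w → f (suc w))

  any-false : ∀ L f → any L f ≡ false → ∀ w → f w ≡ false
  any-false (suc L) f none zero = ∨-conicalˡ _ _ none
  any-false (suc L) f none (suc w) = any-false L _ (∨-conicalʳ _ _ none) w

  count-any : ∀ n L (B : Fin L → Fin n → Bool) →
    count n (λ x → any L (λ w → B w x)) ≤ sumFin L (λ w → count n (B w))
  count-any n zero B = ≤-reflexive (count-false n)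
  count-any n (suc L) B = ≤-trans (count-∨ n (B zero) _) (+-monoʳ-≤ (count n (B zero)) (count-any n L (λ w → B (suc w))))

  count-≟ : ∀ n (y : Fin n) → count n (λ x → ⌊ x ≟ y ⌋) ≡ 1
  count-≟ (suc n) zero = cong suc (trans (count-cong n (λ x → dec-false (suc x ≟ zero) λ ())) (count-false n))
  count-≟ (suc n) (suc y) = trans (count-cong n (λ x → ≟-suc x y)) (count-≟ n y)
    where
    ≟-suc : ∀ {n} (x y : Fin n) → ⌊ suc x ≟ suc y ⌋ ≡ ⌊ x ≟ y ⌋
    ≟-suc x y with x ≟ y
    ... | yes _ = refl
    ... | no  _ = refl

  count-≟ʳ : ∀ n (y : Fin n) → count n (λ x → ⌊ y ≟ x ⌋) ≡ 1
  count-≟ʳ n y = trans (count-cong n ≟-sym) (count-≟ n y)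
    where
    ≟-sym : ∀ x → ⌊ y ≟ x ⌋ ≡ ⌊ x ≟ y ⌋
    ≟-sym x with y ≟ x | x ≟ y
    ... | yes _   | yes _   = refl
    ... | no  _   | no  _   = refl
    ... | yes y≡x | no  x≢y = contradiction (sym y≡x) x≢y
    ... | no  y≢x | yes x≡y = contradiction (sym x≡y) y≢x

  count-partition : ∀ n k P (g : Fin n → Fin k) →
    count n P ≡ sumFin k (λ c → count n (λ x → P x ∧ ⌊ g x ≟ c ⌋))
  count-partition n k P g = begin
    count n P                                                ≡⟨ count≡sumFin n P ⟩
    sumFin n (λ x → indicator (P x))                         ≡⟨ sumFin-cong n fibre ⟩
    sumFin n (λ x → count k (λ c → P x ∧ ⌊ g x ≟ c ⌋))       ≡⟨ count-comm n k _ ⟩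
    sumFin k (λ c → count n (λ x → P x ∧ ⌊ g x ≟ c ⌋))       ∎
    where
    open ≡-Reasoning
    fibre : ∀ x → indicator (P x) ≡ count k (λ c → P x ∧ ⌊ g x ≟ c ⌋)
    fibre x with P x
    ... | true  = sym (count-≟ʳ k (g x))
    ... | false = sym (count-false k)

  room-to-choose : ∀ {E n N U B L τ} → E < n → U ≤ τ → L < τ → E * B ≤ L * n → 2 * τ * n ≤ E * N → U + B < N
  room-to-choose {E} {n} {N} {U} {B} {L} {τ} E<n U≤τ L<τ EB≤Ln 2τn≤EN = *-cancelˡ-< E (U + B) N (begin-strict
    E * (U + B)      ≡⟨ *-distribˡ-+ E U B ⟩
    E * U + E * B    ≤⟨ +-mono-≤ (*-monoʳ-≤ E U≤τ) (≤-trans EB≤Ln (*-monoˡ-≤ n (<⇒≤ L<τ))) ⟩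
    E * τ + τ * n    <⟨ +-monoˡ-< (τ * n) Eτ<τn ⟩
    τ * n + τ * n    ≡⟨ solve 2 (λ τ n → τ :* n :+ τ :* n := con 2 :* τ :* n) refl τ n ⟩
    2 * τ * n        ≤⟨ 2τn≤EN ⟩
    E * N            ∎)
    where
    open ≤-Reasoning
    open +-*-Solver
    Eτ<τn : E * τ < τ * n
    Eτ<τn = subst (_< τ * n) (*-comm τ E) (*-monoʳ-< τ {{>-nonZero (≤-<-trans z≤n L<τ)}} E<n)

  0<n≤m*c⇒0<c : ∀ {n} m {c} → 0 < n → n ≤ m * c → 0 < c
  0<n≤m*c⇒0<c {n} m {zero} 0<n n≤m*0 = contradiction (≤-trans n≤m*0 (≤-reflexive (*-zeroʳ m))) (<⇒≱ 0<n)
  0<n≤m*c⇒0<c m {suc c} _ _ = s≤s z≤n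

module OrderedPairs where

  open import Data.Nat.Properties using (<-irrelevant)
  open import Data.Fin using (Fin; _≟_) renaming (_<_ to _<ᶠ_)
  open import Data.Fin.Properties using (<-cmp; <⇒≢)
  open import Relation.Binary using (tri<; tri≈; tri>)
  open import Relation.Binary.PropositionalEquality
  open import Relation.Nullary using (yes; no; contradiction)

  sym-extend-< : ∀ {L} (R : Fin L → Fin L → Set) → (∀ p q → q <ᶠ p → R q p → R p q) →
                 (∀ p q → p <ᶠ q → R p q) → ∀ p q → p ≢ q → R p q
  sym-extend-< R flip R< p q p≢q with <-cmp p q
  ... | tri< p<q _ _ = R< p q p<q
  ... | tri≈ _ p≡q _ = contradiction p≡q p≢q
  ... | tri> _ _ q<p = flip p q q<p (R< q p q<p)

  module _ {t : ℕ} {A : Set} (diagonal : A) (f : ∀ {p q : Fin t} → p <ᶠ q → A) where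

    symmetrise : Fin t → Fin t → A
    symmetrise p q with <-cmp p q
    ... | tri< p<q _ _ = f p<q
    ... | tri≈ _ _ _   = diagonal
    ... | tri> _ _ q<p = f q<p

    symmetrise-< : ∀ {p q} (p<q : p <ᶠ q) → symmetrise p q ≡ f p<q
    symmetrise-< {p} {q} p<q with <-cmp p q
    ... | tri< p<q′ _ _ = cong f (<-irrelevant p<q′ p<q)
    ... | tri≈ _ p≡q _  = contradiction p≡q (<⇒≢ p<q)
    ... | tri> p≮q _ _  = contradiction p<q p≮q

    symmetrise-> : ∀ {p q} (q<p : q <ᶠ p) → symmetrise p q ≡ f q<p
    symmetrise-> {p} {q} q<p with <-cmp p q
    ... | tri< _ _ q≮p  = contradiction q<p q≮p
    ... | tri≈ _ p≡q _  = contradiction (sym p≡q) (<⇒≢ q<p)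
    ... | tri> _ _ q<p′ = cong f (<-irrelevant q<p′ q<p)

    symmetrise-sym : ∀ p q → symmetrise p q ≡ symmetrise q p
    symmetrise-sym p q with p ≟ q
    ... | yes refl = refl
    ... | no p≢q   = sym-extend-< (λ p q → symmetrise p q ≡ symmetrise q p) (λ _ _ _ → sym)
                       (λ p q p<q → trans (symmetrise-< p<q) (sym (symmetrise-> p<q))) p q p≢q

module MulticolourRamsey where

  open import Data.Nat using (ℕ; zero; suc; _+_; _*_; _≤_; _<_; z≤n; s≤s; pred; >-nonZero)
  open import Data.Nat.Properties renaming (_≟_ to _≟ℕ_)
  open import Data.Bool using (Bool; true; _∧_; not; if_then_else_)
  open import Data.Bool.Properties using (∧-conicalˡ; ∧-conicalʳ)
  open import Data.Fin using (Fin; zero; suc; _≟_)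
  open import Data.Fin.Properties using (any?; toℕ<n)
  open import Data.Product using (∃-syntax; _,_; proj₁)
  open import Function.Definitions using (Injective)
  open import Relation.Binary.PropositionalEquality
  open import Relation.Nullary using (yes; no; contradiction)
  open import Relation.Nullary.Decidable using (⌊_⌋)
  open Counting

  ramseyBound : ℕ → ℕ → ℕ
  ramseyBound k zero = 1
  ramseyBound k (suc s) = 1 + k * ramseyBound k s

  ramseyBound-pos : ∀ k s → 0 < ramseyBound k s
  ramseyBound-pos k zero = s≤s z≤n
  ramseyBound-pos k (suc s) = s≤s z≤n

  decrementAt : ∀ {k} → (Fin k → ℕ) → Fin k → Fin k → ℕ
  decrementAt b c c′ = if ⌊ c′ ≟ c ⌋ then pred (b c′) else b c′

  sumFin-decrementAt : ∀ {k} (b : Fin k → ℕ) c → 0 < b c → suc (sumFin k (decrementAt b c)) ≡ sumFin k b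
  sumFin-decrementAt {k} b c 0<bc = begin
    suc (sumFin k (decrementAt b c))                                       ≡⟨ +-comm 1 _ ⟩
    sumFin k (decrementAt b c) + 1                                         ≡⟨ cong (sumFin k (decrementAt b c) +_) (count-≟ k c) ⟨
    sumFin k (decrementAt b c) + count k (λ c′ → ⌊ c′ ≟ c ⌋)               ≡⟨ cong (sumFin k (decrementAt b c) +_) (count≡sumFin k _) ⟩
    sumFin k (decrementAt b c) + sumFin k (λ c′ → indicator ⌊ c′ ≟ c ⌋)    ≡⟨ sumFin-+ k _ _ ⟨
    sumFin k (λ c′ → decrementAt b c c′ + indicator ⌊ c′ ≟ c ⌋)            ≡⟨ sumFin-cong k restore ⟩
    sumFin k b                                                             ∎
    where
    open ≡-Reasoning
    restore : ∀ c′ → decrementAt b c c′ + indicator ⌊ c′ ≟ c ⌋ ≡ b c′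
    restore c′ with c′ ≟ c
    ... | yes refl = trans (+-comm (pred (b c)) 1) (suc-pred (b c) {{>-nonZero 0<bc}})
    ... | no _ = +-identityʳ (b c′)

  module _ {M k : ℕ} (colour : Fin M → Fin M → Fin k) where

    record MonoClique (S : Fin M → Bool) (b : ℕ) (c : Fin k) : Set where
      field
        vertex        : Fin b → Fin M
        inside        : ∀ p → S (vertex p) ≡ true
        injective     : Injective _≡_ _≡_ vertex
        monochromatic : ∀ p q → p ≢ q → colour (vertex p) (vertex q) ≡ c

    monoClique-empty : ∀ {S c} → MonoClique S 0 c
    monoClique-empty = record { vertex = λ () ; inside = λ () ; injective = λ {} ; monochromatic = λ () }

    monoClique-⊆ : ∀ {S S′ b c} → (∀ x → S x ≡ true → S′ x ≡ true) → MonoClique S b c → MonoClique S′ b c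
    monoClique-⊆ S⊆S′ K = record
      { vertex = vertex ; inside = λ p → S⊆S′ _ (inside p) ; injective = injective ; monochromatic = monochromatic }
      where open MonoClique K

    neighbourhood : (Fin M → Bool) → Fin M → Fin k → Fin M → Bool
    neighbourhood S v c x = (S x ∧ not ⌊ x ≟ v ⌋) ∧ ⌊ colour v x ≟ c ⌋

    module _ (colour-sym : ∀ x y → colour x y ≡ colour y x) where

      module _ {S : Fin M → Bool} {v : Fin M} (v∈S : S v ≡ true) where

        monoClique-cone : ∀ {b c} → MonoClique (neighbourhood S v c) b c → MonoClique S (suc b) c
        monoClique-cone {b} {c} K = record
          { vertex = cone ; inside = cone-inside ; injective = λ {p} {q} → cone-injective p q ; monochromatic = cone-mono }
          where
          open MonoClique K
          S∧≢v : ∀ p → S (vertex p) ∧ not ⌊ vertex p ≟ v ⌋ ≡ true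
          S∧≢v p = ∧-conicalˡ _ ⌊ colour v (vertex p) ≟ c ⌋ (inside p)
          ≢v : ∀ p → vertex p ≢ v
          ≢v p = not⌊⌋-true (vertex p ≟ v) (∧-conicalʳ (S (vertex p)) _ (S∧≢v p))
          v→c : ∀ p → colour v (vertex p) ≡ c
          v→c p = ⌊⌋-true (colour v (vertex p) ≟ c) (∧-conicalʳ (S (vertex p) ∧ not ⌊ vertex p ≟ v ⌋) _ (inside p))
          cone : Fin (suc b) → Fin M
          cone zero = v
          cone (suc p) = vertex p
          cone-inside : ∀ p → S (cone p) ≡ true
          cone-inside zero = v∈S
          cone-inside (suc p) = ∧-conicalˡ _ (not ⌊ vertex p ≟ v ⌋) (S∧≢v p)
          cone-injective : ∀ p q → cone p ≡ cone q → p ≡ q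
          cone-injective zero zero _ = refl
          cone-injective zero (suc q) eq = contradiction (sym eq) (≢v q)
          cone-injective (suc p) zero eq = contradiction eq (≢v p)
          cone-injective (suc p) (suc q) eq = cong suc (injective eq)
          cone-mono : ∀ p q → p ≢ q → colour (cone p) (cone q) ≡ c
          cone-mono zero zero p≢p = contradiction refl p≢p
          cone-mono zero (suc q) _ = v→c q
          cone-mono (suc p) zero _ = trans (colour-sym (vertex p) v) (v→c p)
          cone-mono (suc p) (suc q) p≢q = monochromatic p q (λ eq → p≢q (cong suc eq))

        count≤neighbourhoods : count M S ≤ sumFin k (λ c → count M (neighbourhood S v c)) + 1
        count≤neighbourhoods = subst₂ (λ a b → count M S ≤ a + b)
          (count-partition M k (λ x → S x ∧ not ⌊ x ≟ v ⌋) (colour v)) (count-≟ M v)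
          (count-split M S (λ x → ⌊ x ≟ v ⌋))

        pigeonhole : ∀ R → 1 + k * R ≤ count M S → ∃[ c ] R ≤ count M (neighbourhood S v c)
        pigeonhole R big with any? (λ c → R ≤? count M (neighbourhood S v c))
        ... | yes found = found
        ... | no none = contradiction (begin-strict
          Σ                                                      <⟨ m<n+m Σ 0<k ⟩
          k + Σ                                                  ≡⟨ cong (_+ Σ) (sym (*-identityʳ k)) ⟩
          k * 1 + Σ                                              ≡⟨ cong (_+ Σ) (sumFin-const k 1) ⟨
          sumFin k (λ _ → 1) + Σ                                 ≡⟨ sumFin-+ k (λ _ → 1) _ ⟨
          sumFin k (λ c → 1 + count M (neighbourhood S v c))     ≤⟨ sumFin-≤-* k R (λ c → ≰⇒> (λ le → none (c , le))) ⟩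
          k * R                                                  ≤⟨ kR≤Σ ⟩
          Σ                                                      ∎) (<-irrefl refl)
          where
          open ≤-Reasoning
          Σ : ℕ
          Σ = sumFin k (λ c → count M (neighbourhood S v c))
          0<k : 0 < k
          0<k = <-≤-trans (s≤s z≤n) (toℕ<n (colour v v))
          kR≤Σ : k * R ≤ Σ
          kR≤Σ = ≤-pred (≤-trans big (≤-trans count≤neighbourhoods (≤-reflexive (+-comm Σ 1))))

      ramsey-within : ∀ (b : Fin k → ℕ) s → sumFin k b ≤ s → ∀ S → ramseyBound k s ≤ count M S →
                      ∃[ c ] MonoClique S (b c) c
      ramsey-within b zero Σb≤0 S big = c , subst (λ β → MonoClique S β c) (sym bc≡0) monoClique-empty
        where
        v : Fin M
        v = proj₁ (count-pos⇒∃ M S big)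
        c : Fin k
        c = colour v v
        bc≡0 : b c ≡ 0
        bc≡0 = n≤0⇒n≡0 (≤-trans (term≤sumFin k b c) Σb≤0)
      ramsey-within b (suc s) Σb≤1+s S big with any? (λ c → b c ≟ℕ 0)
      ... | yes (c , bc≡0) = c , subst (λ β → MonoClique S β c) (sym bc≡0) monoClique-empty
      ... | no b≢0 with count-pos⇒∃ M S (≤-trans (s≤s z≤n) big)
      ...   | v , v∈S with pigeonhole v∈S (ramseyBound k s) big
      ...     | c , Nc-large = extend (ramsey-within (decrementAt b c) s Σb′≤s (neighbourhood S v c) Nc-large)
        where
        0<bc : 0 < b c
        0<bc = n≢0⇒n>0 (λ eq → b≢0 (c , eq))
        Σb′≤s : sumFin k (decrementAt b c) ≤ s
        Σb′≤s = ≤-pred (subst (_≤ suc s) (sym (sumFin-decrementAt b c 0<bc)) Σb≤1+s)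
        extend : ∃[ c′ ] MonoClique (neighbourhood S v c) (decrementAt b c c′) c′ → ∃[ c′ ] MonoClique S (b c′) c′
        extend (c′ , K) with c′ ≟ c
        ... | yes refl = c , subst (λ β → MonoClique S β c) (suc-pred (b c) {{>-nonZero 0<bc}}) (monoClique-cone v∈S K)
        ... | no _     = c′ , monoClique-⊆ (λ x x∈N → ∧-conicalˡ _ _ (∧-conicalˡ _ _ x∈N)) K

  ramsey-arrows : ∀ k (b : Fin k → ℕ) → Arrows (ramseyBound k (sumFin k b)) k b
  ramsey-arrows k b φ with ramsey-within (col φ) (csym φ) b _ ≤-refl (λ _ → true) (≤-reflexive (sym (count-true _)))
  ... | c , K = c , vertex , injective , monochromatic
    where open MonoClique K

module NIMEdges where

  open import Data.Nat using (ℕ)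
  open import Data.Nat.Properties using (*-comm)
  open import Data.Rational using (ℚ)
  open import Data.Bool as Bool using (Bool; true; _∧_)
  open import Data.Bool.Properties using (∧-conicalˡ; ∧-conicalʳ; not-¬)
  open import Data.Fin using (Fin; zero; _≟_) renaming (_<_ to _<ᶠ_)
  open import Data.Fin.Properties using (<-cmp; any?)
  open import Data.Product using (∃-syntax; _×_; _,_; proj₁)
  open import Data.Empty using (⊥)
  open import Function using (_∘_)
  open import Function.Bundles using (Equivalence)
  open import Function.Definitions using (Injective)
  open import Relation.Binary using (tri<; tri≈; tri>)
  open import Relation.Binary.PropositionalEquality
  open import Relation.Nullary using (yes; no; contradiction)
  open import Relation.Nullary.Decidable using (⌊_⌋)
  open Counting

  module _ {V : Set} {k : ℕ} (H : Fin k → Graph) (φ : PairColouring V k) where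

    inMonoCopy-sym : ∀ {G i u v} → InMonoCopy φ G i u v → InMonoCopy φ G i v u
    inMonoCopy-sym {G} (f , f-inj , (p , q , pq , fp≡u , fq≡v) , mono) =
      f , f-inj , (q , p , trans (Graph.sym G q p) pq , fq≡v , fp≡u) , mono

    isNIM-sym : ∀ {u v} → IsNIM H φ u v → IsNIM H φ v u
    isNIM-sym nim-uv i copy = nim-uv i (inMonoCopy-sym {H i} copy)

    module _ {nim : V → V → Bool} (nim-spec : NIMIndicator H φ nim) where

      nim-sym : ∀ {u v} → u ≢ v → nim u v ≡ nim v u
      nim-sym {u} {v} u≢v = ≡true-⇔⇒≡
        (λ uv → Equivalence.from (nim-spec v u (u≢v ∘ sym)) (isNIM-sym (Equivalence.to (nim-spec u v u≢v) uv)))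
        (λ vu → Equivalence.from (nim-spec u v u≢v) (isNIM-sym (Equivalence.to (nim-spec v u (u≢v ∘ sym)) vu)))

      nimEdge-in-monoCopy⇒⊥ : ∀ i (F : Fin (n (H i)) → V) → Injective _≡_ _≡_ F →
        (∀ p q → adj (H i) p q ≡ true → col φ (F p) (F q) ≡ i) →
        ∀ {a b} → adj (H i) a b ≡ true → nim (F a) (F b) ≡ true → ⊥
      nimEdge-in-monoCopy⇒⊥ i F F-inj mono {a} {b} ab nim-ab =
        Equivalence.to (nim-spec (F a) (F b) Fa≢Fb) nim-ab i (F , F-inj , (a , b , ab , refl , refl) , mono)
        where
        Fa≢Fb : F a ≢ F b
        Fa≢Fb Fa≡Fb with F-inj Fa≡Fb
        ... | refl = not-¬ (Graph.irref (H i) a) ab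

  module _ {k m : ℕ} {sz : Fin m → ℕ} (φ : PairColouring (Vert m sz) k) (nim : Vert m sz → Vert m sz → Bool) where

    pairDensity : Fin k → Fin m → Fin m → ℚ
    pairDensity ℓ i j = density φ nim ℓ i j (full φ nim (sz i)) (full φ nim (sz j))

    nimEdge⇒colour : ∀ {ℓ u v} → nimEdge φ nim ℓ u v ≡ true → col φ u v ≡ ℓ
    nimEdge⇒colour {ℓ} {u} {v} uv = ⌊⌋-true (col φ u v ≟ ℓ) (∧-conicalʳ (nim u v) _ uv)

    nimEdge⇒nim : ∀ {ℓ u v} → nimEdge φ nim ℓ u v ≡ true → nim u v ≡ true
    nimEdge⇒nim {ℓ} {u} {v} = ∧-conicalˡ (nim u v) _

    module _ (H : Fin k → Graph) (nim-spec : NIMIndicator H φ nim) where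

      nimEdge-sym : ∀ ℓ {u v} → u ≢ v → nimEdge φ nim ℓ u v ≡ nimEdge φ nim ℓ v u
      nimEdge-sym ℓ {u} {v} u≢v = cong₂ _∧_ (nim-sym H φ nim-spec u≢v) (cong (λ c → ⌊ c ≟ ℓ ⌋) (csym φ u v))

      pairDensity-sym : ∀ ℓ {i j} → i ≢ j → pairDensity ℓ i j ≡ pairDensity ℓ j i
      pairDensity-sym ℓ {i} {j} i≢j = cong₂ ratio
        (trans (count-comm (sz i) (sz j) (λ x y → nimEdge φ nim ℓ (i , x) (j , y)))
          (sumFin-cong (sz j) (λ y → count-cong (sz i) (λ x → nimEdge-sym ℓ (λ eq → i≢j (cong proj₁ eq))))))
        (*-comm (count (sz i) _) (count (sz j) _))

  nonBipartite⇒edge : ∀ G → NonBipartite G → ∃[ a ] ∃[ b ] a <ᶠ b × adj G a b ≡ true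
  nonBipartite⇒edge G nonBip with any? (λ a → any? (λ b → adj G a b Bool.≟ true))
  ... | no none = contradiction ((λ _ → zero) , λ u v uv _ → none (u , v , uv)) nonBip
  ... | yes (a , b , ab) with <-cmp a b
  ...   | tri< a<b _ _ = a , b , a<b , ab
  ...   | tri≈ _ refl _ = contradiction ab (not-¬ (Graph.irref G a))
  ...   | tri> _ _ b<a = b , a , b<a , trans (Graph.sym G b a) ab

module DenseEmbedding {m k : ℕ} {sz : Fin m → ℕ} (edge : Fin k → Vert m sz → Vert m sz → Bool)
                      (D E : ℕ) .{{_ : NonZero D}} where

  open import Data.Nat using (ℕ; zero; suc; _+_; _*_; _^_; _≤_; _<_; z≤n; s≤s; pred; >-nonZero)
  open import Data.Nat.Properties hiding (_≟_)
  open import Data.Bool using (Bool; true; false; _∧_; _∨_; not; if_then_else_)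
  open import Data.Bool.Properties using (∧-conicalˡ; ∧-conicalʳ; ∨-conicalˡ; ∨-zeroʳ; not-¬)
  open import Data.Fin using (Fin; zero; suc; _≟_) renaming (_<_ to _<ᶠ_)
  open import Data.Maybe using (Maybe; just; nothing)
  open import Data.Product using (∃-syntax; _×_; _,_; proj₁; proj₂)
  open import Function using (_∘_)
  open import Function.Definitions using (Injective)
  open import Relation.Binary.PropositionalEquality
  open import Relation.Nullary using (yes; no; contradiction)
  open import Relation.Nullary.Decidable using (⌊_⌋)
  open Counting
  open OrderedPairs using (sym-extend-<)

  edgeCount : Fin k → (i j : Fin m) → (Fin (sz i) → Bool) → (Fin (sz j) → Bool) → ℕ
  edgeCount ℓ i j X Y = sumFin (sz i) λ x → count (sz j) (λ y → X x ∧ Y y ∧ edge ℓ (i , x) (j , y))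

  Dense : Fin k → Fin m → Fin m → Set
  Dense ℓ i j = ∀ X Y → sz i ≤ E * count (sz i) X → sz j ≤ E * count (sz j) Y →
                count (sz i) X * count (sz j) Y ≤ D * edgeCount ℓ i j X Y

  record DenseClique (t : ℕ) : Set where
    field
      part      : Fin t → Fin m
      colouring : PairColouring (Fin t) k
      dense     : ∀ p q → p ≢ q → Dense (col colouring p q) (part p) (part q)

  neighbours : Fin k → (i : Fin m) → Fin (sz i) → (j : Fin m) → (Fin (sz j) → Bool) → Fin (sz j) → Bool
  neighbours ℓ i x j Y y = Y y ∧ edge ℓ (i , x) (j , y)

  lowDegree : Fin k → (i j : Fin m) → (Fin (sz j) → Bool) → Fin (sz i) → Bool
  lowDegree ℓ i j Y x = ⌊ D * count (sz j) (neighbours ℓ i x j Y) <? count (sz j) Y ⌋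

  few-lowDegree : ∀ {ℓ i j} → Dense ℓ i j → 0 < sz i → ∀ {Y} → sz j ≤ E * count (sz j) Y →
                  E * count (sz i) (lowDegree ℓ i j Y) < sz i
  few-lowDegree {ℓ} {i} {j} dense 0<szi {Y} Y-large with E * count (sz i) (lowDegree ℓ i j Y) <? sz i
  ... | yes few = few
  ... | no ¬few = contradiction (dense B Y B-large Y-large)
                    (<⇒≱ (≤-<-trans De≤|B|pred|Y| (*-monoʳ-< |B| {{>-nonZero 0<|B|}} pred|Y|<|Y|)))
    where
    B : Fin (sz i) → Bool
    B = lowDegree ℓ i j Y
    |B| |Y| : ℕ
    |B| = count (sz i) B
    |Y| = count (sz j) Y
    B-large : sz i ≤ E * |B|
    B-large = ≮⇒≥ ¬few
    0<|B| : 0 < |B|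
    0<|B| = 0<n≤m*c⇒0<c E 0<szi B-large
    0<|Y| : 0 < |Y|
    0<|Y| with count-pos⇒∃ (sz i) B 0<|B|
    ... | x , x∈B = ≤-<-trans z≤n (⌊⌋-true (_ <? |Y|) x∈B)
    pred|Y|<|Y| : pred |Y| < |Y|
    pred|Y|<|Y| = m≤pred[n]⇒suc[m]≤n {{>-nonZero 0<|Y|}} ≤-refl
    per-vertex : ∀ x → D * count (sz j) (λ y → B x ∧ Y y ∧ edge ℓ (i , x) (j , y)) ≤ (if B x then pred |Y| else 0)
    per-vertex x with B x in Bx
    ... | true  = <⇒≤pred (⌊⌋-true (_ <? |Y|) Bx)
    ... | false = ≤-reflexive (trans (cong (D *_) (count-false (sz j))) (*-zeroʳ D))
    De≤|B|pred|Y| : D * edgeCount ℓ i j B Y ≤ |B| * pred |Y|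
    De≤|B|pred|Y| = begin
      D * edgeCount ℓ i j B Y ≡⟨ sumFin-*ˡ (sz i) D _ ⟨
      sumFin (sz i) (λ x → D * count (sz j) (λ y → B x ∧ Y y ∧ edge ℓ (i , x) (j , y))) ≤⟨ sumFin-mono (sz i) per-vertex ⟩
      sumFin (sz i) (λ x → if B x then pred |Y| else 0) ≡⟨ sumFin-indicator (sz i) B (pred |Y|) ⟩
      |B| * pred |Y| ∎
      where open ≤-Reasoning

  record Template (L : ℕ) : Set where
    field
      part       : Fin L → Fin m
      edgeColour : Fin L → Fin L → Maybe (Fin k)

  open Template

  DenseTemplate : ∀ {L} → Template L → Set
  DenseTemplate T = ∀ {ℓ} j w → j <ᶠ w → edgeColour T j w ≡ just ℓ → Dense ℓ (part T j) (part T w)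

  dropFirst : ∀ {L} → Template (suc L) → Template L
  dropFirst T = record
    { part = λ w → part T (suc w) ; edgeColour = λ j w → edgeColour T (suc j) (suc w) }

  Candidates : ∀ {L} → Template L → Set
  Candidates {L} T = (w : Fin L) → Fin (sz (part T w)) → Bool

  Used : Set
  Used = (i : Fin m) → Fin (sz i) → Bool

  record Embedding {L} (T : Template L) (C : Candidates T) (used : Used) : Set where
    field
      vertex    : (w : Fin L) → Fin (sz (part T w))
      candidate : ∀ w → C w (vertex w) ≡ true
      unused    : ∀ w → used (part T w) (vertex w) ≡ false
      edges     : ∀ {ℓ} j w → j <ᶠ w → edgeColour T j w ≡ just ℓ →
                  edge ℓ (part T j , vertex j) (part T w , vertex w) ≡ true
      distinct  : ∀ j w → j <ᶠ w → _≢_ {A = Vert m sz} (part T j , vertex j) (part T w , vertex w)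

    point : Fin L → Vert m sz
    point w = part T w , vertex w

    point-injective : Injective _≡_ _≡_ point
    point-injective {p} {q} eq with p ≟ q
    ... | yes p≡q = p≡q
    ... | no p≢q  = contradiction eq
                      (sym-extend-< (λ p q → point p ≢ point q) (λ _ _ _ q≢p → q≢p ∘ sym) distinct p q p≢q)

  lowDegreeIf : Maybe (Fin k) → (i j : Fin m) → (Fin (sz j) → Bool) → Fin (sz i) → Bool
  lowDegreeIf (just ℓ) = lowDegree ℓ
  lowDegreeIf nothing  i j Y x = false

  neighboursIf : Maybe (Fin k) → (i : Fin m) → Fin (sz i) → (j : Fin m) → (Fin (sz j) → Bool) → Fin (sz j) → Bool
  neighboursIf (just ℓ) = neighbours ℓ
  neighboursIf nothing  i x j Y = Y

  few-lowDegreeIf : ∀ c {i j} → (∀ {ℓ} → c ≡ just ℓ → Dense ℓ i j) → 0 < sz i →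
                    ∀ {Y} → sz j ≤ E * count (sz j) Y → E * count (sz i) (lowDegreeIf c i j Y) ≤ sz i
  few-lowDegreeIf (just ℓ) dense 0<szi Y-large = <⇒≤ (few-lowDegree (dense refl) 0<szi Y-large)
  few-lowDegreeIf nothing {i} _ _ _ = ≤-trans (≤-reflexive (trans (cong (E *_) (count-false (sz i))) (*-zeroʳ E))) z≤n

  neighboursIf-large : ∀ c i x j Y → lowDegreeIf c i j Y x ≡ false →
                       count (sz j) Y ≤ D * count (sz j) (neighboursIf c i x j Y)
  neighboursIf-large (just ℓ) i x j Y high = ≮⇒≥ (⌊⌋-false (_ <? count (sz j) Y) high)
  neighboursIf-large nothing  i x j Y _ = m≤n*m (count (sz j) Y) D

  markUsed : Used → (i₀ : Fin m) → Fin (sz i₀) → Used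
  markUsed used i₀ u i y with i ≟ i₀
  ... | yes refl = used i y ∨ ⌊ y ≟ u ⌋
  ... | no _     = used i y

  markUsed-marks : ∀ used i₀ u → markUsed used i₀ u i₀ u ≡ true
  markUsed-marks used i₀ u with i₀ ≟ i₀
  ... | no i₀≢i₀ = contradiction refl i₀≢i₀
  ... | yes refl with u ≟ u
  ...   | yes _  = ∨-zeroʳ (used i₀ u)
  ...   | no u≢u = contradiction refl u≢u

  markUsed-unused : ∀ used i₀ u i y → markUsed used i₀ u i y ≡ false → used i y ≡ false
  markUsed-unused used i₀ u i y unmarked with i ≟ i₀
  ... | yes refl = ∨-conicalˡ (used i y) _ unmarked
  ... | no _     = unmarked

  markUsed-fresh : ∀ used i₀ u i y → markUsed used i₀ u i y ≡ false → _≢_ {A = Vert m sz} (i , y) (i₀ , u)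
  markUsed-fresh used i₀ u i y unmarked refl = not-¬ unmarked (markUsed-marks used i₀ u)

  count-markUsed : ∀ used i₀ u {U} → (∀ i → count (sz i) (used i) ≤ U) →
                   ∀ i → count (sz i) (markUsed used i₀ u i) ≤ suc U
  count-markUsed used i₀ u {U} few i with i ≟ i₀
  ... | yes refl = ≤-trans (count-∨ (sz i) (used i) _)
                     (≤-trans (+-mono-≤ (few i) (≤-reflexive (count-≟ (sz i) u))) (≤-reflexive (+-comm U 1)))
  ... | no _     = m≤n⇒m≤1+n (few i)

  neighboursIf-⊆ : ∀ c i x j Y y → neighboursIf c i x j Y y ≡ true → Y y ≡ true
  neighboursIf-⊆ (just ℓ) i x j Y y = ∧-conicalˡ (Y y) _
  neighboursIf-⊆ nothing  i x j Y y = λ Yy → Yy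

  neighboursIf-edge : ∀ {c ℓ} → c ≡ just ℓ → ∀ i x j Y y →
                      neighboursIf c i x j Y y ≡ true → edge ℓ (i , x) (j , y) ≡ true
  neighboursIf-edge refl i x j Y y = ∧-conicalʳ (Y y) _

  lowDegreeFor : ∀ {L} (T : Template (suc L)) → Candidates T → Fin L → Fin (sz (part T zero)) → Bool
  lowDegreeFor T C w = lowDegreeIf (edgeColour T zero (suc w)) (part T zero) (part T (suc w)) (C (suc w))

  candidatesAfter : ∀ {L} (T : Template (suc L)) → Candidates T → Fin (sz (part T zero)) → Candidates (dropFirst T)
  candidatesAfter T C u w =
    neighboursIf (edgeColour T zero (suc w)) (part T zero) u (part T (suc w)) (C (suc w))

  module _ (τ : ℕ) (E-large : 2 * τ * D ^ τ ≤ E) (parts-large : ∀ i → E < sz i) where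

    2τD^s≤E : ∀ {s} → s ≤ τ → 2 * τ * D ^ s ≤ E
    2τD^s≤E s≤τ = ≤-trans (*-monoʳ-≤ (2 * τ) (^-monoʳ-≤ D s≤τ)) E-large

    D^s≤E : ∀ {s} → s < τ → D ^ s ≤ E
    D^s≤E {s} s<τ = ≤-trans (m≤n*m (D ^ s) (2 * τ) {{>-nonZero 0<2τ}}) (2τD^s≤E (<⇒≤ s<τ))
      where
      0<2τ : 0 < 2 * τ
      0<2τ = ≤-trans (≤-<-trans z≤n s<τ) (m≤n*m τ 2)

    few-lowDegreeFor : ∀ {L} (T : Template (suc L)) → DenseTemplate T → (C : Candidates T) →
                       (∀ w → sz (part T (suc w)) ≤ E * count (sz (part T (suc w))) (C (suc w))) →
                       E * count (sz (part T zero)) (λ x → any L (λ w → lowDegreeFor T C w x)) ≤ L * sz (part T zero)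
    few-lowDegreeFor {L} T dense C C-large = begin
      E * count n₀ (λ x → any L (λ w → lowDegreeFor T C w x))  ≤⟨ *-monoʳ-≤ E (count-any n₀ L (lowDegreeFor T C)) ⟩
      E * sumFin L (λ w → count n₀ (lowDegreeFor T C w))       ≡⟨ sumFin-*ˡ L E _ ⟨
      sumFin L (λ w → E * count n₀ (lowDegreeFor T C w))       ≤⟨ sumFin-≤-* L n₀ few ⟩
      L * n₀                                                   ∎
      where
      open ≤-Reasoning
      n₀ : ℕ
      n₀ = sz (part T zero)
      few : ∀ w → E * count n₀ (lowDegreeFor T C w) ≤ n₀
      few w = few-lowDegreeIf (edgeColour T zero (suc w)) (dense zero (suc w) (s≤s z≤n))
                (≤-<-trans z≤n (parts-large (part T zero))) (C-large w)

    choose-first : ∀ {L} (T : Template (suc L)) → DenseTemplate T → ∀ {s U} (C : Candidates T) →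
                   (∀ w → sz (part T w) ≤ D ^ s * count (sz (part T w)) (C w)) →
                   (used : Used) → (∀ i → count (sz i) (used i) ≤ U) → s + suc L ≤ τ → U + suc L ≤ τ →
                   ∃[ u ] (C zero u ≡ true) × (used (part T zero) u ≡ false) × (∀ w → lowDegreeFor T C w u ≡ false)
    choose-first {L} T dense {s} {U} C C-large used few s+L<τ U+L<τ =
      u , ∧-conicalˡ (C zero u) (not (used i₀ u)) C∧unused ,
      not≡true⇒≡false (∧-conicalʳ (C zero u) (not (used i₀ u)) C∧unused) ,
      any-false L (λ w → lowDegreeFor T C w u) (not≡true⇒≡false (∧-conicalʳ _ (not (bad u)) (proj₂ picked)))
      where
      i₀ : Fin m
      i₀ = part T zero
      bad good : Fin (sz i₀) → Bool
      bad x = any L (λ w → lowDegreeFor T C w x)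
      good x = (C zero x ∧ not (used i₀ x)) ∧ not (bad x)
      C-large′ : ∀ w → sz (part T (suc w)) ≤ E * count (sz (part T (suc w))) (C (suc w))
      C-large′ w = ≤-trans (C-large (suc w)) (*-monoˡ-≤ _ (D^s≤E (<-≤-trans (m<m+n s (s≤s z≤n)) s+L<τ)))
      2τn≤EN : 2 * τ * sz i₀ ≤ E * count (sz i₀) (C zero)
      2τn≤EN = ≤-trans (*-monoʳ-≤ (2 * τ) (C-large zero)) (≤-trans (≤-reflexive (sym (*-assoc (2 * τ) (D ^ s) _)))
                 (*-monoˡ-≤ _ (2τD^s≤E (≤-trans (m≤m+n s (suc L)) s+L<τ))))
      bad+U<N : count (sz i₀) bad + U < count (sz i₀) (C zero)
      bad+U<N = subst (_< count (sz i₀) (C zero)) (+-comm U _)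
        (room-to-choose (parts-large i₀) (≤-trans (m≤m+n U (suc L)) U+L<τ) (≤-trans (m≤n+m (suc L) U) U+L<τ)
          (few-lowDegreeFor T dense C C-large′) 2τn≤EN)
      N≤good+bad+U : count (sz i₀) (C zero) ≤ count (sz i₀) good + (count (sz i₀) bad + U)
      N≤good+bad+U = ≤-trans (count-split (sz i₀) (C zero) (used i₀))
        (≤-trans (+-monoˡ-≤ _ (count-split (sz i₀) (λ x → C zero x ∧ not (used i₀ x)) bad))
        (≤-trans (≤-reflexive (+-assoc (count (sz i₀) good) _ _))
          (+-monoʳ-≤ (count (sz i₀) good) (+-monoʳ-≤ _ (few i₀)))))
      picked : ∃[ x ] good x ≡ true
      picked = count-pos⇒∃ (sz i₀) good (n≢0⇒n>0 λ none →
        <⇒≱ bad+U<N (subst (λ g → count (sz i₀) (C zero) ≤ g + (count (sz i₀) bad + U)) none N≤good+bad+U))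
      u : Fin (sz i₀)
      u = proj₁ picked
      C∧unused : C zero u ∧ not (used i₀ u) ≡ true
      C∧unused = ∧-conicalˡ (C zero u ∧ not (used i₀ u)) (not (bad u)) (proj₂ picked)

    cons-embedding : ∀ {L} (T : Template (suc L)) (C : Candidates T) (used : Used) u →
                     C zero u ≡ true → used (part T zero) u ≡ false →
                     Embedding (dropFirst T) (candidatesAfter T C u) (markUsed used (part T zero) u) →
                     Embedding T C used
    cons-embedding {L} T C used u C∋u unused-u rest = record
      { vertex = vertex′ ; candidate = candidate′ ; unused = unused′ ; edges = edges′ ; distinct = distinct′ }
      where
      open Embedding rest
      i₀ = part T zero
      vertex′ : (w : Fin (suc L)) → Fin (sz (part T w))
      vertex′ zero = u
      vertex′ (suc w) = vertex w
      candidate′ : ∀ w → C w (vertex′ w) ≡ true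
      candidate′ zero = C∋u
      candidate′ (suc w) = neighboursIf-⊆ (edgeColour T zero (suc w)) i₀ u _ (C (suc w)) (vertex w) (candidate w)
      unused′ : ∀ w → used (part T w) (vertex′ w) ≡ false
      unused′ zero = unused-u
      unused′ (suc w) = markUsed-unused used i₀ u _ (vertex w) (unused w)
      edges′ : ∀ {ℓ} j w → j <ᶠ w → edgeColour T j w ≡ just ℓ →
               edge ℓ (part T j , vertex′ j) (part T w , vertex′ w) ≡ true
      edges′ zero (suc w) _ req = neighboursIf-edge req i₀ u _ (C (suc w)) (vertex w) (candidate w)
      edges′ (suc j) (suc w) (s≤s j<w) req = edges j w j<w req
      distinct′ : ∀ j w → j <ᶠ w → _≢_ {A = Vert m sz} (part T j , vertex′ j) (part T w , vertex′ w)
      distinct′ zero (suc w) _ eq = markUsed-fresh used i₀ u _ (vertex w) (unused w) (sym eq)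
      distinct′ (suc j) (suc w) (s≤s j<w) = distinct j w j<w

    -- Each chosen vertex avoids the low-degree vertices of every later part, so later candidate
    -- sets shrink by a factor at most D per step and stay 1/E-fractions, where density applies.
    embed : ∀ {L} (T : Template L) → DenseTemplate T → ∀ s U (C : Candidates T) →
            (∀ w → sz (part T w) ≤ D ^ s * count (sz (part T w)) (C w)) →
            (used : Used) → (∀ i → count (sz i) (used i) ≤ U) → s + L ≤ τ → U + L ≤ τ → Embedding T C used
    embed {zero} T _ _ _ C _ used _ _ _ =
      record { vertex = λ () ; candidate = λ () ; unused = λ () ; edges = λ () ; distinct = λ () }
    embed {suc L} T dense s U C C-large used few s+L≤τ U+L≤τ
      with choose-first T dense C C-large used few s+L≤τ U+L≤τ
    ... | u , C∋u , unused-u , high = cons-embedding T C used u C∋u unused-u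
      (embed (dropFirst T) (λ j w j<w → dense (suc j) (suc w) (s≤s j<w)) (suc s) (suc U) (candidatesAfter T C u) C′-large
             (markUsed used (part T zero) u) (count-markUsed used (part T zero) u few)
             (subst (_≤ τ) (+-suc s L) s+L≤τ) (subst (_≤ τ) (+-suc U L) U+L≤τ))
      where
      C′-large : ∀ w → sz (part T (suc w)) ≤ D ^ suc s * count (sz (part T (suc w))) (candidatesAfter T C u w)
      C′-large w = ≤-trans (C-large (suc w)) (≤-trans
        (*-monoʳ-≤ (D ^ s) (neighboursIf-large (edgeColour T zero (suc w)) _ u _ (C (suc w)) (high w)))
        (≤-reflexive (trans (sym (*-assoc (D ^ s) D _)) (cong (_* count _ (candidatesAfter T C u w)) (*-comm (D ^ s) D)))))

    embed-template : ∀ {L} (T : Template L) → DenseTemplate T → L ≤ τ → Embedding T (λ _ _ → true) (λ _ _ → false)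
    embed-template T dense L≤τ = embed T dense 0 0 (λ _ _ → true)
      (λ w → ≤-reflexive (sym (trans (*-identityˡ _) (count-true _)))) (λ _ _ → false)
      (λ i → ≤-reflexive (count-false (sz i))) L≤τ L≤τ

module FeasibleColourings where

  open import Data.Nat using (ℕ; suc; _+_; _*_; _^_; _≤_; _<_; >-nonZero)
  open import Data.Nat.Properties hiding (_≟_)
  open import Data.Bool using (Bool; true; if_then_else_)
  open import Data.Bool.Properties using (not-¬)
  open import Data.Fin using (Fin; _≟_; _↑ˡ_; _↑ʳ_; splitAt) renaming (_<_ to _<ᶠ_)
  open import Data.Fin.Properties
    using (any?; all?; ¬∀⟶∃¬; splitAt-↑ˡ; splitAt-↑ʳ; toℕ-↑ˡ; toℕ-↑ʳ; toℕ<n; ↑ʳ-injective)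
    renaming (<⇒≢ to <⇒≢ᶠ)
  open import Data.Maybe using (Maybe; just; nothing)
  open import Data.Product using (Σ; ∃-syntax; _×_; _,_; proj₁; proj₂)
  open import Data.Sum using (_⊎_; inj₁; inj₂; [_,_]′)
  open import Data.Empty using (⊥)
  open import Function using (_∘_)
  open import Function.Definitions using (Injective)
  open import Relation.Binary.PropositionalEquality
  open import Relation.Nullary using (¬_; yes; no; contradiction; ¬?)
  open import Relation.Nullary.Decidable using (_→-dec_; decidable-stable)
  open Counting
  open MulticolourRamsey using (ramseyBound; ramseyBound-pos; ramsey-arrows)
  open OrderedPairs using (sym-extend-<)
  open NIMEdges

  module Cone {V : Set} {k : ℕ} (φ : PairColouring V k) (c : Fin k) {L : ℕ} (a : Fin L) (apex : V) (base : Fin L → V)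
           (base-injective : Injective _≡_ _≡_ base) (apex∉base : ∀ v → apex ≢ base v)
           (apex-colour : ∀ v → col φ apex (base v) ≡ c)
           (base-colour : ∀ u v → u ≢ v → col φ (base u) (base v) ≡ c) where

    coneAt : Fin L → V
    coneAt v with v ≟ a
    ... | yes _ = apex
    ... | no  _ = base v

    coneAt-apex : coneAt a ≡ apex
    coneAt-apex with a ≟ a
    ... | yes _   = refl
    ... | no a≢a = contradiction refl a≢a

    coneAt-base : ∀ {v} → v ≢ a → coneAt v ≡ base v
    coneAt-base {v} v≢a with v ≟ a
    ... | yes v≡a = contradiction v≡a v≢a
    ... | no  _   = refl

    coneAt-injective : Injective _≡_ _≡_ coneAt
    coneAt-injective {u} {v} eq with u ≟ a | v ≟ a
    ... | yes u≡a | yes v≡a = trans u≡a (sym v≡a)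
    ... | yes _   | no  _   = contradiction eq (apex∉base v)
    ... | no  _   | yes _   = contradiction (sym eq) (apex∉base u)
    ... | no  _   | no  _   = base-injective eq

    coneAt-colour : ∀ u v → u ≢ v → col φ (coneAt u) (coneAt v) ≡ c
    coneAt-colour u v u≢v with u ≟ a | v ≟ a
    ... | yes u≡a | yes v≡a = contradiction (trans u≡a (sym v≡a)) u≢v
    ... | yes _   | no  _   = apex-colour v
    ... | no  _   | yes _   = trans (csym φ (base u) apex) (apex-colour u)
    ... | no  _   | no  _   = base-colour u v u≢v

  fanSize : ∀ {k} → (Fin k → Graph) → ℕ
  fanSize {k} H = ramseyBound k (sumFin k (λ c → n (H c)))

  budget : ∀ {k} → (Fin k → Graph) → ℕ
  budget {k} H = k + fanSize H + sumFin k (λ c → n (H c))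

  n≤budget : ∀ {k} (H : Fin k → Graph) i → n (H i) ≤ budget H
  n≤budget {k} H i = ≤-trans (term≤sumFin k (λ c → n (H c)) i) (m≤n+m _ (k + fanSize H))

  fan≤budget : ∀ {k} (H : Fin k → Graph) → k + fanSize H ≤ budget H
  fan≤budget {k} H = m≤m+n (k + fanSize H) _

  0<budget : ∀ {k} (H : Fin k → Graph) → 0 < budget H
  0<budget {k} H = ≤-trans (ramseyBound-pos k (sumFin k (λ c → n (H c)))) (≤-trans (m≤n+m (fanSize H) k) (fan≤budget H))

  threshold : ∀ {k} → (Fin k → Graph) → ℕ → ℕ
  threshold H d = 2 * budget H * suc d ^ budget H

  n≤threshold : ∀ {k} (H : Fin k → Graph) d → d ≤ threshold H d
  n≤threshold H d = begin
    d                              ≤⟨ n≤1+n d ⟩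
    suc d                          ≡⟨ *-identityʳ (suc d) ⟨
    suc d ^ 1                      ≤⟨ ^-monoʳ-≤ (suc d) (0<budget H) ⟩
    suc d ^ budget H               ≤⟨ m≤n*m (suc d ^ budget H) (2 * budget H) {{>-nonZero 0<2τ}} ⟩
    2 * budget H * suc d ^ budget H ∎
    where
    open ≤-Reasoning
    0<2τ : 0 < 2 * budget H
    0<2τ = ≤-trans (0<budget H) (m≤n*m (budget H) 2)

  module _ {k : ℕ} (H : Fin k → Graph) (nonBipartite : ∀ i → NonBipartite (H i))
           {m : ℕ} {sz : Fin m → ℕ} (φ : PairColouring (Vert m sz) k) (nim : Vert m sz → Vert m sz → Bool)
           (nim-spec : NIMIndicator H φ nim) where

    record Fan : Set where
      field
        hub            : Fin k → Vert m sz
        leaf           : Fin (fanSize H) → Vert m sz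
        leaf-injective : Injective _≡_ _≡_ leaf
        hub≢leaf       : ∀ c p → hub c ≢ leaf p
        spoke          : ∀ c p → nimEdge φ nim c (hub c) (leaf p) ≡ true

    leafColouring : Fan → PairColouring (Fin (fanSize H)) k
    leafColouring F = record { col = λ p q → col φ (leaf p) (leaf q) ; csym = λ p q → csym φ (leaf p) (leaf q) }
      where open Fan F

    -- Ramsey gives a colour-c clique on |H c| leaves; swapping one of its vertices for the hub of
    -- colour c makes a colour-c copy of H c through the NIM-edge from the hub.
    fan⇒⊥ : Fan → ⊥
    fan⇒⊥ F with ramsey-arrows k (λ c → n (H c)) (leafColouring F)
    ... | c , g , g-injective , g-mono with nonBipartite⇒edge (H c) (nonBipartite c)
    ...   | a , b , a<b , ab = nimEdge-in-monoCopy⇒⊥ H φ nim-spec c coneAt coneAt-injective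
              (λ u v uv → coneAt-colour u v (λ { refl → not-¬ (Graph.irref (H c) u) uv })) ab nim-ab
      where
      open Fan F
      open Cone φ c a (hub c) (λ v → leaf (g v)) (λ eq → g-injective (leaf-injective eq)) (λ v → hub≢leaf c (g v))
                  (λ v → nimEdge⇒colour φ nim (spoke c (g v))) g-mono
      nim-ab : nim (coneAt a) (coneAt b) ≡ true
      nim-ab = subst₂ (λ u v → nim u v ≡ true) (sym coneAt-apex) (sym (coneAt-base (<⇒≢ᶠ a<b ∘ sym)))
                 (nimEdge⇒nim φ nim (spoke c (g b)))

    module _ (D E : ℕ) .{{_ : NonZero D}} (τ : ℕ) (E-large : 2 * τ * D ^ τ ≤ E) (parts-large : ∀ i → E < sz i)
             {t : ℕ} (K : DenseEmbedding.DenseClique (nimEdge φ nim) D E t) where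

      open DenseEmbedding (nimEdge φ nim) D E
      open DenseClique K

      homTemplate : ∀ i → (Fin (n (H i)) → Fin t) → Template (n (H i))
      homTemplate i h = record { part = λ p → part (h p) ; edgeColour = λ p q → if adj (H i) p q then just i else nothing }

      no-homomorphism : ∀ i → n (H i) ≤ τ → ¬ (Σ (Fin (n (H i)) → Fin t) λ h → ∀ p q → adj (H i) p q ≡ true →
                          (h p ≢ h q) × (col colouring (h p) (h q) ≡ i))
      no-homomorphism i n≤τ (h , hom) with nonBipartite⇒edge (H i) (nonBipartite i)
      ... | a , b , a<b , ab =
        nimEdge-in-monoCopy⇒⊥ H φ nim-spec i point point-injective mono ab (nimEdge⇒nim φ nim (edges a b a<b (required ab)))
        where
        required : ∀ {p q} → adj (H i) p q ≡ true → Template.edgeColour (homTemplate i h) p q ≡ just i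
        required = cong (λ x → if x then just i else nothing)
        dense-T : DenseTemplate (homTemplate i h)
        dense-T j w _ eq with adj (H i) j w in jw
        dense-T j w _ refl | true =
          subst (λ ℓ → Dense ℓ (part (h j)) (part (h w))) (proj₂ (hom j w jw)) (dense (h j) (h w) (proj₁ (hom j w jw)))
        open Embedding (embed-template τ E-large parts-large (homTemplate i h) dense-T n≤τ)
        mono : ∀ p q → adj (H i) p q ≡ true → col φ (point p) (point q) ≡ i
        mono p q pq = sym-extend-< (λ p q → adj (H i) p q ≡ true → col φ (point p) (point q) ≡ i)
          (λ p q _ qp⇒ pq → trans (csym φ (point p) (point q)) (qp⇒ (trans (Graph.sym (H i) q p) pq)))
          (λ p q p<q pq → nimEdge⇒colour φ nim (edges p q p<q (required pq)))
          p q (λ { refl → not-¬ (Graph.irref (H i) p) pq }) pq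

      fanColour : Fin k ⊎ Fin (fanSize H) → Fin k ⊎ Fin (fanSize H) → Maybe (Fin k)
      fanColour (inj₁ c) (inj₂ _) = just c
      fanColour _        _        = nothing

      fanTemplate : Fin t → (Fin k → Fin t) → Template (k + fanSize H)
      fanTemplate x y = record
        { part = λ w → [ (λ c → part (y c)) , (λ _ → part x) ]′ (splitAt k w)
        ; edgeColour = λ j w → fanColour (splitAt k j) (splitAt k w) }

      rainbow⇒fan : k + fanSize H ≤ τ → ∀ x → (∀ c → ∃[ y ] (y ≢ x) × (col colouring x y ≡ c)) → Fan
      rainbow⇒fan kM≤τ x rainbow = record
        { hub = λ c → point (c ↑ˡ fanSize H)
        ; leaf = λ p → point (k ↑ʳ p)
        ; leaf-injective = λ eq → ↑ʳ-injective k _ _ (point-injective eq)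
        ; hub≢leaf = λ c p eq → <⇒≢ᶠ (hub<leaf c p) (point-injective eq)
        ; spoke = λ c p → edges (c ↑ˡ fanSize H) (k ↑ʳ p) (hub<leaf c p)
                            (cong₂ fanColour (splitAt-↑ˡ k c (fanSize H)) (splitAt-↑ʳ k (fanSize H) p)) }
        where
        y : Fin k → Fin t
        y c = proj₁ (rainbow c)
        dense-T : DenseTemplate (fanTemplate x y)
        dense-T j w _ eq with splitAt k j | splitAt k w
        dense-T j w _ refl | inj₁ c | inj₂ _ = subst (λ ℓ → Dense ℓ (part (y c)) (part x))
          (trans (csym colouring (y c) x) (proj₂ (proj₂ (rainbow c)))) (dense (y c) x (proj₁ (proj₂ (rainbow c))))
        open Embedding (embed-template τ E-large parts-large (fanTemplate x y) dense-T kM≤τ)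
        hub<leaf : ∀ c p → c ↑ˡ fanSize H <ᶠ k ↑ʳ p
        hub<leaf c p = subst₂ _<_ (sym (toℕ-↑ˡ c (fanSize H))) (sym (toℕ-↑ʳ k p)) (≤-trans (toℕ<n c) (m≤m+n k _))

      unseen-colour : k + fanSize H ≤ τ → ∀ x → ∃[ c ] ∀ y → y ≢ x → col colouring x y ≢ c
      unseen-colour kM≤τ x with any? (λ c → all? (λ y → ¬? (y ≟ x) →-dec ¬? (col colouring x y ≟ c)))
      ... | yes unseen = unseen
      ... | no  none = contradiction (rainbow⇒fan kM≤τ x seen) fan⇒⊥
        where
        seen : ∀ c → ∃[ y ] (y ≢ x) × (col colouring x y ≡ c)
        seen c with ¬∀⟶∃¬ t _ (λ y → ¬? (y ≟ x) →-dec ¬? (col colouring x y ≟ c)) (λ all → none (c , all))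
        ... | y , ¬unseen = y , (λ y≡x → ¬unseen (λ y≢x → contradiction y≡x y≢x)) ,
                            decidable-stable (col colouring x y ≟ c) (λ ≢c → ¬unseen (λ _ → ≢c))

      denseClique⇒feasible : (∀ i → n (H i) ≤ τ) → k + fanSize H ≤ τ → HasFeasible k H t
      denseClique⇒feasible n≤τ kM≤τ = (λ x → proj₁ (unseen-colour kM≤τ x)) , colouring ,
        (λ i → no-homomorphism i (n≤τ i)) , (λ x y x≢y → proj₂ (unseen-colour kM≤τ x) y (x≢y ∘ sym))

module RegularPairs where

  open import Data.Nat as ℕ using (ℕ; suc)
  import Data.Nat.Properties as ℕ
  open import Data.Bool using (Bool)
  open import Data.Fin using (Fin; zero; fromℕ<) renaming (_<_ to _<ᶠ_)
  open import Data.Fin.Properties using (<⇒≢)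
  open import Data.Product using (_,_; proj₁; proj₂)
  open import Data.Rational using (ℚ; _≤_; _+_; _*_)
  open import Data.Rational.Properties using (≤-trans; *-monoʳ-≤-nonNeg)
  open import Relation.Binary.PropositionalEquality
  open Fractions
  open OrderedPairs using (sym-extend-<; symmetrise; symmetrise-<; symmetrise-sym)
  open NIMEdges using (pairDensity; pairDensity-sym)
  open FeasibleColourings

  module _ {k m : ℕ} {sz : Fin m → ℕ} (φ : PairColouring (Vert m sz) k) (nim : Vert m sz → Vert m sz → Bool) where

    regular⇒dense : ∀ {ε γ d e ℓ i j} → frac 1 d + frac 1 d ≤ γ → ε ≤ frac 1 e → d ℕ.≤ e →
      Regular φ nim ε ℓ i j → γ ≤ pairDensity φ nim ℓ i j →
      DenseEmbedding.Dense (nimEdge φ nim) (suc d) (suc e) ℓ i j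
    regular⇒dense {ε} {γ} {d} {e} halves≤γ ε≤1/e d≤e regular γ≤density X Y X-large Y-large =
      unitFrac≤ratio⇒≤ {d} (p+p≤q⇒∣q-r∣≤p⇒p≤r (≤-trans halves≤γ γ≤density)
        (≤-trans (regular X Y (fraction X-large) (fraction Y-large)) ε≤1/d))
      where
      ε≤1/d : ε ≤ frac 1 d
      ε≤1/d = ≤-trans ε≤1/e (frac-mono-≤ {1} {e} {1} {d} (ℕ.*-monoʳ-≤ 1 (ℕ.s≤s d≤e)))
      fraction : ∀ {a Z} → a ℕ.≤ suc e ℕ.* count a Z → ε * ℕtoℚ a ≤ ℕtoℚ (count a Z)
      fraction {a} large = ≤-trans (*-monoʳ-≤-nonNeg (ℕtoℚ a) {{frac-nonNeg a 0}} ε≤1/e) (unitFrac-*-≤ {b = e} large)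

  module _ {k : ℕ} (H : Fin k → Graph) {m : ℕ} {sz : Fin m → ℕ} (φ : PairColouring (Vert m sz) k)
           (nim : Vert m sz → Vert m sz → Bool) (nim-spec : NIMIndicator H φ nim)
           {ε γ : ℚ} {d e : ℕ} (halves≤γ : frac 1 d + frac 1 d ≤ γ) (ε≤1/e : ε ≤ frac 1 e) (d≤e : d ℕ.≤ e) where

    open DenseEmbedding (nimEdge φ nim) (suc d) (suc e)

    reducedClique⇒denseClique : ∀ {t} → Fin k → ReducedHasClique φ nim ε γ t → DenseClique t
    reducedClique⇒denseClique {t} c₀ (f , f-injective , reduced) = record { part = f ; colouring = ξ ; dense = dense }
      where
      densest : ∀ {p q : Fin t} → p <ᶠ q → Fin k
      densest p<q = proj₁ (proj₂ (proj₂ (reduced _ _ (<⇒≢ p<q))))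
      ξ : PairColouring (Fin t) k
      ξ = record { col = symmetrise c₀ densest ; csym = symmetrise-sym c₀ densest }
      DenseIn : Fin t → Fin t → Set
      DenseIn p q = γ ≤ pairDensity φ nim (col ξ p q) (f p) (f q)
      γ-dense : ∀ p q → p ≢ q → DenseIn p q
      γ-dense = sym-extend-< DenseIn flip ordered
        where
        ordered : ∀ p q → p <ᶠ q → DenseIn p q
        ordered p q p<q = subst (λ ℓ → γ ≤ pairDensity φ nim ℓ (f p) (f q))
          (sym (symmetrise-< c₀ densest p<q)) (proj₂ (proj₂ (proj₂ (reduced p q (<⇒≢ p<q)))))
        flip : ∀ p q → q <ᶠ p → DenseIn q p → DenseIn p q
        flip p q q<p = subst (γ ≤_) (trans (cong (λ ℓ → pairDensity φ nim ℓ (f q) (f p)) (symmetrise-sym c₀ densest q p))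
          (pairDensity-sym φ nim H nim-spec (col ξ p q) (λ fq≡fp → <⇒≢ q<p (f-injective fq≡fp))))
      dense : ∀ p q → p ≢ q → Dense (col ξ p q) (f p) (f q)
      dense p q p≢q =
        regular⇒dense φ nim halves≤γ ε≤1/e d≤e (proj₁ (proj₂ (reduced p q p≢q)) (col ξ p q)) (γ-dense p q p≢q)

  reducedClique⇒feasible : ∀ {k} (H : Fin k → Graph) → (∀ i → NonBipartite (H i)) →
    ∀ {m} {sz : Fin m → ℕ} (φ : PairColouring (Vert m sz) k) (nim : Vert m sz → Vert m sz → Bool) → NIMIndicator H φ nim →
    ∀ {ε γ d} → frac 1 d + frac 1 d ≤ γ → ε ≤ frac 1 (threshold H d) → (∀ i → suc (threshold H d) ℕ.< sz i) →
    ∀ {t} → ReducedHasClique φ nim ε γ (suc t) → HasFeasible k H (suc t)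
  reducedClique⇒feasible H nonBipartite {sz = sz} φ nim nim-spec {d = d} halves≤γ ε≤1/e parts-large clique@(f , _) =
    denseClique⇒feasible H nonBipartite φ nim nim-spec (suc d) (suc (threshold H d)) (budget H) (ℕ.n≤1+n _) parts-large
      (reducedClique⇒denseClique H φ nim nim-spec halves≤γ ε≤1/e (n≤threshold H d) (col φ v v) clique)
      (n≤budget H) (fan≤budget H)
    where
    v : Vert _ sz
    v = f zero , fromℕ< (ℕ.≤-trans (ℕ.s≤s ℕ.z≤n) (parts-large (f zero)))

open import Data.Nat using (suc; _+_; _∸_) renaming (_≤_ to _≤ℕ_)
import Data.Nat.Properties as ℕ
open import Data.Product using (∃-syntax; _×_; _,_)
open import Data.Rational using (ℚ; _≤_; _<_; _*_; 0ℚ; 1ℚ)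
open import Relation.Nullary using (¬_)
open import Relation.Binary.PropositionalEquality using (refl; sym)
open Fractions using (frac; frac-pos; unitFrac-*-≤; positive⇒∃unitFrac+unitFrac≤)
open FeasibleColourings using (threshold)
open RegularPairs using (reducedClique⇒feasible)

lemma4p1 :
    (k : ℕ) (H : Fin k → Graph) → (∀ i → NonBipartite (H i)) →
    (a : Fin k → ℕ) → (∀ i → IsChromaticNumber (H i) (a i)) →
    (r : ℕ) → IsRamseyNumber k (λ i → a i ∸ 1) r →
    (r* : ℕ) → IsRStar k H r* →
    ∃[ γ₀ ] (0ℚ < γ₀) × (γ₀ * ℕtoℚ k ≤ 1ℚ) × (γ₀ * ℕtoℚ r ≤ 1ℚ) ×
      (∀ (γ : ℚ) → 0ℚ < γ → γ ≤ γ₀ →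
        ∃[ ε₀ ] (0ℚ < ε₀) ×
          (∀ (ε : ℚ) → 0ℚ < ε → ε ≤ ε₀ →
            ∃[ N₀ ] (∀ (N : ℕ) → N₀ ≤ℕ N →
              ∀ (m : ℕ) (sz : Fin m → ℕ) → (∀ i → N ≤ℕ sz i) →
              ∀ (φ : PairColouring (Vert m sz) k)
                (nim : Vert m sz → Vert m sz → Bool) →
                NIMIndicator H φ nim →
                ¬ ReducedHasClique φ nim ε γ (suc r*))))
lemma4p1 k H nonBipartite _ _ r _ r* (_ , r*-maximal) =
  frac 1 (k + r) , frac-pos 0 (k + r) , γ₀*≤1 (ℕ.m≤m+n k r) , γ₀*≤1 (ℕ.m≤n+m r k) ,
  λ γ 0<γ _ →
    let d , halves≤γ = positive⇒∃unitFrac+unitFrac≤ 0<γ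
        e = threshold H d
    in frac 1 e , frac-pos 0 e , λ ε _ ε≤1/e → suc (suc e) , λ N N₀≤N m sz N≤sz φ nim nim-spec clique →
         ℕ.<-irrefl refl (r*-maximal (suc r*) (reducedClique⇒feasible H nonBipartite φ nim nim-spec halves≤γ ε≤1/e
           (λ i → ℕ.≤-trans N₀≤N (N≤sz i)) clique))
  where
  γ₀*≤1 : ∀ {x} → x ≤ℕ k + r → frac 1 (k + r) * ℕtoℚ x ≤ 1ℚ
  γ₀*≤1 {x} x≤k+r = unitFrac-*-≤ {x} {k + r} {1}
    (ℕ.≤-trans x≤k+r (ℕ.≤-trans (ℕ.n≤1+n _) (ℕ.≤-reflexive (sym (ℕ.*-identityʳ _)))))
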